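{- Let $q$ be a prime power, let $\mathsf{H}(3,q^2)$ be the Hermitian surface of $\mathrm{PG}(3,q^2)$ defined by the Hermitian form $\langle X,Y\rangle=X_0Y_0^q+X_1Y_1^q+X_2Y_2^q+X_3Y_3^q$, let $\pi$ be the plane $X_3=0$, let $\mathcal{O}=\pi\cap\mathsf{H}(3,q^2)$, and let $G_{\mathcal{O}}$ be the stabiliser of $\mathcal{O}$ in $\mathsf{PGU}_4(q)$; its elements are represented (projectively) by matrices $M_A=\begin{pmatrix}A&0\\0&1\end{pmatrix}$ with $A\in\mathsf{GU}_3(q)$. Let $\mathsf{SU}_3$ denote the group of collineations of $\mathsf{H}(3,q^2)$ given by the matrices $M_A$ with $A\in\mathsf{SU}_3(q)$. Let $b$ be a Baer subgenerator of $\mathsf{H}(3,q^2)$ with a point in $\mathcal{O}$. Then the stabiliser of $b$ in $G_{\mathcal{O}}$ is contained in $\mathsf{SU}_3$.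
   Context: A generator of $\mathsf{H}(3,q^2)$ is a totally isotropic line with respect to the Hermitian form. A Baer subline of a line $\mathrm{PG}(1,q^2)$ is a set of $q+1$ points forming a subgeometry $\mathrm{PG}(1,q)$; a Baer subgenerator is a Baer subline contained in a generator. $\mathsf{SU}_3(q)$ is the group of $3\times 3$ matrices over $\mathrm{GF}(q^2)$ of determinant $1$ preserving the Hermitian form $X_0Y_0^q+X_1Y_1^q+X_2Y_2^q$. -}

module Defs where

open import Level using (Level; _⊔_)
open import Data.Nat as ℕ using (ℕ; suc)
import Data.Fin
open import Data.Nat.Primality using (Prime)
open import Data.Fin using (Fin; zero; suc)
open import Data.Product using (Σ; ∃; _×_; _,_)
open import Relation.Nullary using (¬_)
open import Relation.Binary.PropositionalEquality using (_≡_)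
open import Algebra.Bundles using (CommutativeRing)

IsPrimePower : ℕ → Set
IsPrimePower q = Σ ℕ λ p → Σ ℕ λ k → Prime p × q ≡ p ℕ.^ suc k

record IsFiniteField {c ℓ : Level} (R : CommutativeRing c ℓ) (n : ℕ) : Set (c ⊔ ℓ) where
  open CommutativeRing R
  field
    nontrivial : ¬ (1# ≈ 0#)
    inverse    : ∀ x → ¬ (x ≈ 0#) → Σ Carrier λ y → x * y ≈ 1#
    enum       : Fin n → Carrier
    enum-surj  : ∀ x → Σ (Fin n) λ i → enum i ≈ x
    enum-inj   : ∀ i j → enum i ≈ enum j → i ≡ j

-- Geometry of PG(3,q²) over a field R = GF(q²).
module Hermitian {c ℓ : Level} (R : CommutativeRing c ℓ) (q : ℕ) where
  open CommutativeRing R using (Carrier; _≈_; _+_; _*_; _-_; 0#; 1#)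

  pow : Carrier → ℕ → Carrier
  pow x ℕ.zero    = 1#
  pow x (ℕ.suc n) = x * pow x n

  frob : Carrier → Carrier
  frob x = pow x q

  InSubfield : Carrier → Set ℓ
  InSubfield x = frob x ≈ x

  V3 : Set c
  V3 = Fin 3 → Carrier

  V4 : Set c
  V4 = Fin 4 → Carrier

  Mat3 : Set c
  Mat3 = Fin 3 → Fin 3 → Carrier

  herm3 : V3 → V3 → Carrier
  herm3 x y = x zero * frob (y zero) + x (suc zero) * frob (y (suc zero))
            + x (suc (suc zero)) * frob (y (suc (suc zero)))

  herm4 : V4 → V4 → Carrier
  herm4 x y = x zero * frob (y zero) + x (suc zero) * frob (y (suc zero))
            + x (suc (suc zero)) * frob (y (suc (suc zero)))
            + x (suc (suc (suc zero))) * frob (y (suc (suc (suc zero))))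

  NonZero4 : V4 → Set ℓ
  NonZero4 x = ¬ (∀ i → x i ≈ 0#)

  SamePoint : V4 → V4 → Set (c ⊔ ℓ)
  SamePoint x y = Σ Carrier λ k → ∀ i → x i ≈ k * y i

  lin : Carrier → V4 → Carrier → V4 → V4
  lin a u b v i = a * u i + b * v i

  Independent : V4 → V4 → Set (c ⊔ ℓ)
  Independent u v = ∀ a b → (∀ i → lin a u b v i ≈ 0#) → (a ≈ 0#) × (b ≈ 0#)

  TotallyIsotropic : V4 → V4 → Set (c ⊔ ℓ)
  TotallyIsotropic u v = ∀ a b a' b' → herm4 (lin a u b v) (lin a' u b' v) ≈ 0#

  Generator : V4 → V4 → Set (c ⊔ ℓ)
  Generator u v = Independent u v × TotallyIsotropic u v

  -- the Baer subline of ⟨u,v⟩ determined by the basis (u,v):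
  -- the points ⟨λu+μv⟩ with λ, μ ∈ GF(q) not both zero
  InBaer : V4 → V4 → V4 → Set (c ⊔ ℓ)
  InBaer u v x = NonZero4 x × Σ Carrier λ a → Σ Carrier λ b →
    InSubfield a × InSubfield b × ¬ ((a ≈ 0#) × (b ≈ 0#)) × SamePoint x (lin a u b v)

  InPlaneπ : V4 → Set ℓ
  InPlaneπ x = x (suc (suc (suc zero))) ≈ 0#

  app3 : Mat3 → V3 → V3
  app3 A x i = A i zero * x zero + A i (suc zero) * x (suc zero)
             + A i (suc (suc zero)) * x (suc (suc zero))

  det3 : Mat3 → Carrier
  det3 A = a00 * (a11 * a22 - a12 * a21)
         - a01 * (a10 * a22 - a12 * a20)
         + a02 * (a10 * a21 - a11 * a20)
    where
      a00 = A zero zero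
      a01 = A zero (suc zero)
      a02 = A zero (suc (suc zero))
      a10 = A (suc zero) zero
      a11 = A (suc zero) (suc zero)
      a12 = A (suc zero) (suc (suc zero))
      a20 = A (suc (suc zero)) zero
      a21 = A (suc (suc zero)) (suc zero)
      a22 = A (suc (suc zero)) (suc (suc zero))

  IsGU3 : Mat3 → Set (c ⊔ ℓ)
  IsGU3 A = ∀ x y → herm3 (app3 A x) (app3 A y) ≈ herm3 x y

  IsSU3 : Mat3 → Set (c ⊔ ℓ)
  IsSU3 A = IsGU3 A × det3 A ≈ 1#

  first3 : V4 → V3
  first3 x i = x (Data.Fin.inject₁ i)

  MA : Mat3 → V4 → V4
  MA A x zero                   = app3 A (first3 x) zero
  MA A x (suc zero)             = app3 A (first3 x) (suc zero)
  MA A x (suc (suc zero))       = app3 A (first3 x) (suc (suc zero))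
  MA A x (suc (suc (suc zero))) = x (suc (suc (suc zero)))

  Stabilises : Mat3 → (V4 → Set (c ⊔ ℓ)) → Set (c ⊔ ℓ)
  Stabilises A P = (∀ x → P x → P (MA A x))
                 × (∀ y → P y → Σ V4 λ x → P x × SamePoint y (MA A x))

  SameCollineation : Mat3 → Mat3 → Set (c ⊔ ℓ)
  SameCollineation A B = ∀ x → NonZero4 x → SamePoint (MA A x) (MA B x)

module Submission where

-- For M_A ∈ G_O stabilising b ⊂ ⟨u,v⟩ we show det A = 1, so A itself is the required
-- element of SU₃(q).  Let P be the point of b in π and Q a point of b off π (a generator
-- is never contained in π, as the Hermitian curve π ∩ H(3,q²) contains no line).  The
-- points of b are the ⟨ξP + ηQ⟩ with ξ, η ∈ GF(q), and M_A fixes the last coordinate, so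
-- M_A P = λP and M_A Q = sP + Q with λ, s ∈ GF(q), λ ≠ 0.  On π this says that the
-- unitary matrix A has the isotropic eigenvector p (the π-part of P) and acts as a shear
-- on the π-part w of Q, w ⊥ p.  Comparing the actions of the cofactor matrix of A on
-- p × w and on p̄ gives λ = λ̄ det A, and λ̄ = λ ≠ 0 forces det A = 1.

open import Level using (Level)
open import Algebra.Bundles using (CommutativeRing)
open import Data.Nat as ℕ using (ℕ; zero; suc)
open import Data.Fin as Fin using (Fin; inject₁)
open import Data.Fin.Patterns
open import Data.Product using (Σ; _×_; _,_; proj₁; proj₂)
open import Data.Sum using (_⊎_; inj₁; inj₂)
open import Data.Empty using (⊥-elim)
open import Relation.Nullary using (¬_; Dec; yes; no)
open import Relation.Binary.PropositionalEquality as ≡ using (_≡_)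
open import Data.Nat.Primality using (Prime)
open import Defs

-- A ring solver with integer coefficients for an arbitrary commutative ring,
-- obtained from the canonical ring morphism ℤ → R.
module IntegerRingSolver {c ℓ : Level} (R : CommutativeRing c ℓ) where
  open import Data.Integer as ℤ using (ℤ; +_; -[1+_]; _◃_; _⊖_; sign; ∣_∣)
  import Data.Integer.Properties as ℤ
  open import Data.Sign as Sign using (Sign)
  open import Data.Maybe using (Maybe; just; nothing)
  open import Algebra.Solver.Ring.AlmostCommutativeRing
    using (_-Raw-AlmostCommutative⟶_; fromCommutativeRing)
  open CommutativeRing R
  open import Relation.Binary.Reasoning.Setoid setoid
  open import Algebra.Properties.Ring ring using (-1*x≈-x)
  open import Algebra.Properties.CommutativeSemigroup *-commutativeSemigroup using (interchange)
  open import Algebra.Properties.AbelianGroup +-abelianGroup using (⁻¹-∙-comm)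
  open import Algebra.Properties.Group +-group using (ε⁻¹≈ε; ⁻¹-involutive)
  open import Algebra.Properties.Semiring.Mult semiring using (×-homo-+; ×1-homo-*) renaming (_×_ to _·_)

  ιℤ : ℤ → Carrier
  ιℤ (+ n)      = n · 1#
  ιℤ -[1+ n ]   = - (suc n · 1#)

  1+a-1+b : ∀ a b → (1# + a) - (1# + b) ≈ a - b
  1+a-1+b a b = begin
    (1# + a) + - (1# + b)   ≈⟨ +-congˡ (sym (⁻¹-∙-comm 1# b)) ⟩
    (1# + a) + (- 1# + - b) ≈⟨ +-assoc _ _ _ ⟩
    1# + (a + (- 1# + - b)) ≈⟨ +-congˡ (sym (+-assoc _ _ _)) ⟩
    1# + ((a + - 1#) + - b) ≈⟨ +-congˡ (+-congʳ (+-comm _ _)) ⟩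
    1# + ((- 1# + a) + - b) ≈⟨ +-congˡ (+-assoc _ _ _) ⟩
    1# + (- 1# + (a - b))   ≈⟨ sym (+-assoc _ _ _) ⟩
    (1# + - 1#) + (a - b)   ≈⟨ +-congʳ (-‿inverseʳ 1#) ⟩
    0# + (a - b)            ≈⟨ +-identityˡ _ ⟩
    a - b                   ∎

  -- ιℤ is a ring morphism; multiplication is handled through ι(i) = sign(i)·|i|
  ι-⊖ : ∀ m n → ιℤ (m ⊖ n) ≈ m · 1# - n · 1#
  ι-⊖ m zero = sym (trans (+-congˡ ε⁻¹≈ε) (+-identityʳ _))
  ι-⊖ zero (suc n) = sym (+-identityˡ _)
  ι-⊖ (suc m) (suc n) = begin
    ιℤ (suc m ⊖ suc n)             ≡⟨ ≡.cong ιℤ (ℤ.[1+m]⊖[1+n]≡m⊖n m n) ⟩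
    ιℤ (m ⊖ n)                     ≈⟨ ι-⊖ m n ⟩
    m · 1# - n · 1#                ≈⟨ sym (1+a-1+b _ _) ⟩
    suc m · 1# - suc n · 1#        ∎

  ι-+ : ∀ i j → ιℤ (i ℤ.+ j) ≈ ιℤ i + ιℤ j
  ι-+ (+ m)    (+ n)    = ×-homo-+ 1# m n
  ι-+ (+ m)    -[1+ n ] = ι-⊖ m (suc n)
  ι-+ -[1+ m ] (+ n)    = trans (ι-⊖ n (suc m)) (+-comm _ _)
  ι-+ -[1+ m ] -[1+ n ] = begin
    - (suc (suc (m ℕ.+ n)) · 1#)         ≡⟨ ≡.cong (λ k → - (suc k · 1#)) (≡.sym (ℕ+-suc m n)) ⟩
    - ((suc m ℕ.+ suc n) · 1#)           ≈⟨ -‿cong (×-homo-+ 1# (suc m) (suc n)) ⟩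
    - (suc m · 1# + suc n · 1#)          ≈⟨ sym (⁻¹-∙-comm _ _) ⟩
    - (suc m · 1#) + - (suc n · 1#)      ∎
    where open import Data.Nat.Properties using () renaming (+-suc to ℕ+-suc)

  ιs : Sign → Carrier
  ιs Sign.+ = 1#
  ιs Sign.- = - 1#

  ι-◃ : ∀ s n → ιℤ (s ◃ n) ≈ ιs s * (n · 1#)
  ι-◃ s        zero    = sym (zeroʳ _)
  ι-◃ Sign.+ (suc n) = sym (*-identityˡ _)
  ι-◃ Sign.- (suc n) = sym (-1*x≈-x _)

  ι-sign-abs : ∀ i → ιℤ i ≈ ιs (sign i) * (∣ i ∣ · 1#)
  ι-sign-abs (+ n)    = sym (*-identityˡ _)
  ι-sign-abs -[1+ n ] = sym (-1*x≈-x _)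

  ιs-* : ∀ s t → ιs (s Sign.* t) ≈ ιs s * ιs t
  ιs-* Sign.+ Sign.+ = sym (*-identityˡ _)
  ιs-* Sign.+ Sign.- = sym (*-identityˡ _)
  ιs-* Sign.- Sign.+ = sym (*-identityʳ _)
  ιs-* Sign.- Sign.- = sym (trans (-1*x≈-x _) (⁻¹-involutive _))

  ι-* : ∀ i j → ιℤ (i ℤ.* j) ≈ ιℤ i * ιℤ j
  ι-* i j = begin
    ιℤ (sign i Sign.* sign j ◃ ∣ i ∣ ℕ.* ∣ j ∣)              ≈⟨ ι-◃ (sign i Sign.* sign j) (∣ i ∣ ℕ.* ∣ j ∣) ⟩
    ιs (sign i Sign.* sign j) * ((∣ i ∣ ℕ.* ∣ j ∣) · 1#)      ≈⟨ *-cong (ιs-* (sign i) (sign j)) (×1-homo-* ∣ i ∣ ∣ j ∣) ⟩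
    (ιs (sign i) * ιs (sign j)) * ((∣ i ∣ · 1#) * (∣ j ∣ · 1#)) ≈⟨ interchange _ _ _ _ ⟩
    (ιs (sign i) * (∣ i ∣ · 1#)) * (ιs (sign j) * (∣ j ∣ · 1#)) ≈⟨ sym (*-cong (ι-sign-abs i) (ι-sign-abs j)) ⟩
    ιℤ i * ιℤ j                                                ∎

  ι-neg : ∀ i → ιℤ (ℤ.- i) ≈ - ιℤ i
  ι-neg (+ zero)  = sym ε⁻¹≈ε
  ι-neg (+ suc n) = refl
  ι-neg -[1+ n ]  = sym (⁻¹-involutive _)

  ι-morphism : ℤ.+-*-rawRing -Raw-AlmostCommutative⟶ fromCommutativeRing R
  ι-morphism = record
    { ⟦_⟧ = ιℤ ; +-homo = ι-+ ; *-homo = ι-* ; -‿homo = ι-neg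
    ; 0-homo = refl ; 1-homo = +-identityʳ 1# }

  coefficient-equality : ∀ i j → Maybe (ιℤ i ≈ ιℤ j)
  coefficient-equality i j with i ℤ.≟ j
  ... | yes ≡.refl = just refl
  ... | no _       = nothing

  open import Algebra.Solver.Ring ℤ.+-*-rawRing (fromCommutativeRing R) ι-morphism coefficient-equality public

module BinomialDivisibility where
  open import Data.Nat
  open import Data.Nat.Properties
  open import Data.Nat.Combinatorics
  open import Data.Nat.Divisibility
  open import Data.Nat.Primality using (euclidsLemma)
  open import Data.Nat.Solver using (module +-*-Solver)
  open +-*-Solver
  open import Relation.Binary.PropositionalEquality
  open ≡-Reasoning

  absorption : ∀ n k → suc k * (suc n C suc k) ≡ suc n * (n C k)
  absorption zero    zero    = refl
  absorption zero    (suc k) = *-zeroʳ (suc (suc k))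
  absorption (suc n) zero    = trans (*-identityˡ _) (trans (nC1≡n (suc (suc n))) (sym (*-identityʳ _)))
  absorption (suc n) (suc k) = begin
    suc (suc k) * (suc (suc n) C suc (suc k))
      ≡⟨ cong (suc (suc k) *_) (sym (nCk+nC[k+1]≡[n+1]C[k+1] (suc n) (suc k))) ⟩
    suc (suc k) * (X + Y)
      ≡⟨ solve 3 (λ k X Y → (con 2 :+ k) :* (X :+ Y) := ((con 1 :+ k) :* X) :+ X :+ ((con 2 :+ k) :* Y)) refl k X Y ⟩
    suc k * X + X + suc (suc k) * Y
      ≡⟨ cong₂ (λ a b → a + X + b) (absorption n k) (absorption n (suc k)) ⟩
    suc n * (n C k) + X + suc n * (n C suc k)
      ≡⟨ solve 4 (λ n a X b → (con 1 :+ n) :* a :+ X :+ (con 1 :+ n) :* b := (con 1 :+ n) :* (a :+ b) :+ X) refl n (n C k) X (n C suc k) ⟩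
    suc n * (n C k + n C suc k) + X
      ≡⟨ cong (λ z → suc n * z + X) (nCk+nC[k+1]≡[n+1]C[k+1] n k) ⟩
    suc n * X + X
      ≡⟨ solve 2 (λ n X → (con 1 :+ n) :* X :+ X := (con 2 :+ n) :* X) refl n X ⟩
    suc (suc n) * X ∎
    where
    X = suc n C suc k
    Y = suc n C suc (suc k)

  -- p ∣ (k+1)·C(p,k+1) = p·C(p-1,k), and p ∤ k+1 since k+1 < p
  prime∣binomial : ∀ {p} k → Prime p → suc k < p → p ∣ (p C suc k)
  prime∣binomial {suc n} k pr k<p
    with euclidsLemma (suc k) (suc n C suc k) pr (divides (n C k) (trans (absorption n k) (*-comm (suc n) (n C k))))
  ... | inj₁ p∣k+1 = ⊥-elim (<⇒≱ k<p (∣⇒≤ p∣k+1))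
  ... | inj₂ p∣C   = p∣C

module FiniteField {c ℓ : Level} (R : CommutativeRing c ℓ) (N : ℕ) (F : IsFiniteField R N) where
  open CommutativeRing R
  open IsFiniteField F
  open import Relation.Binary.Reasoning.Setoid setoid
  open import Algebra.Properties.Semiring.Mult semiring using () renaming (_×_ to _·_)

  -- equality is decidable, by comparing indices in the enumeration
  _≟_ : ∀ x y → Dec (x ≈ y)
  x ≟ y with enum-surj x | enum-surj y
  ... | i , ei | j , ej with i Fin.≟ j
  ...   | yes ≡.refl = yes (trans (sym ei) ej)
  ...   | no i≢j     = no (λ x≈y → i≢j (enum-inj i j (trans ei (trans x≈y (sym ej)))))

  *-cancelˡ : ∀ {x y z} → ¬ (x ≈ 0#) → x * y ≈ x * z → y ≈ z
  *-cancelˡ {x} {y} {z} x≉0 e with inverse x x≉0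
  ... | x⁻¹ , xx⁻¹≈1 = begin
    y             ≈⟨ sym (*-identityˡ y) ⟩
    1# * y        ≈⟨ *-congʳ x⁻¹x≈1 ⟨
    (x⁻¹ * x) * y ≈⟨ *-assoc x⁻¹ x y ⟩
    x⁻¹ * (x * y) ≈⟨ *-congˡ e ⟩
    x⁻¹ * (x * z) ≈⟨ sym (*-assoc x⁻¹ x z) ⟩
    (x⁻¹ * x) * z ≈⟨ *-congʳ x⁻¹x≈1 ⟩
    1# * z        ≈⟨ *-identityˡ z ⟩
    z             ∎
    where x⁻¹x≈1 = trans (*-comm x⁻¹ x) xx⁻¹≈1

  *-cancelʳ : ∀ {x y z} → ¬ (x ≈ 0#) → y * x ≈ z * x → y ≈ z
  *-cancelʳ x≉0 e = *-cancelˡ x≉0 (trans (*-comm _ _) (trans e (*-comm _ _)))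

  zero-divisor : ∀ x y → x * y ≈ 0# → (x ≈ 0#) ⊎ (y ≈ 0#)
  zero-divisor x y xy≈0 with x ≟ 0#
  ... | yes x≈0 = inj₁ x≈0
  ... | no x≉0  = inj₂ (*-cancelˡ x≉0 (trans xy≈0 (sym (zeroʳ x))))

  *-nonzero : ∀ {x y} → ¬ (x ≈ 0#) → ¬ (y ≈ 0#) → ¬ (x * y ≈ 0#)
  *-nonzero x≉0 y≉0 xy≈0 with zero-divisor _ _ xy≈0
  ... | inj₁ x≈0 = x≉0 x≈0
  ... | inj₂ y≈0 = y≉0 y≈0

  nonzero-coordinate : ∀ {n} (v : Fin n → Carrier) → ¬ (∀ i → v i ≈ 0#) → Σ (Fin n) λ i → ¬ (v i ≈ 0#)
  nonzero-coordinate {n} v = ¬∀⟶∃¬ n (λ i → v i ≈ 0#) (λ i → v i ≟ 0#)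
    where open import Data.Fin.Properties using (¬∀⟶∃¬)

  -- additive Lagrange: adding N copies of 1 gives 0.  Translation by 1 permutes the
  -- field, so the sum S of all elements satisfies S = N·1 + S.
  order-annihilates : N · 1# ≈ 0#
  order-annihilates = ∙-cancelʳ S _ _ (begin
    N · 1# + S                     ≈⟨ +-congʳ (sym (sum-replicate N)) ⟩
    sum {N} (λ _ → 1#) + S         ≈⟨ sym (∑-distrib-+ {N} (λ _ → 1#) enum) ⟩
    sum {N} (λ i → 1# + enum i)    ≈⟨ sum-cong-≋ {N} (λ i → sym (proj₂ (enum-surj (1# + enum i)))) ⟩
    sum {N} (λ i → enum (shift i)) ≈⟨ sym (sum-permute enum (permutation shift unshift shift-unshift unshift-shift)) ⟩
    S                              ≈⟨ sym (+-identityˡ S) ⟩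
    0# + S                         ∎)
    where
    open import Algebra.Properties.CommutativeMonoid.Sum +-commutativeMonoid
      using (sum; sum-permute; ∑-distrib-+; sum-cong-≋; sum-replicate)
    open import Data.Fin.Permutation using (permutation)
    open import Algebra.Properties.Group +-group using (∙-cancelʳ)
    index : Carrier → Fin N
    index y = proj₁ (enum-surj y)
    index-enum : ∀ y → enum (index y) ≈ y
    index-enum y = proj₂ (enum-surj y)
    shift unshift : Fin N → Fin N
    shift i   = index (1# + enum i)
    unshift i = index (enum i - 1#)
    shift-unshift : ∀ i → shift (unshift i) ≡ i
    shift-unshift i = enum-inj _ _ (begin
      enum (shift (unshift i)) ≈⟨ index-enum _ ⟩
      1# + enum (unshift i)    ≈⟨ +-congˡ (index-enum _) ⟩
      1# + (enum i - 1#)       ≈⟨ +-comm _ _ ⟩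
      (enum i - 1#) + 1#       ≈⟨ +-assoc _ _ _ ⟩
      enum i + (- 1# + 1#)     ≈⟨ +-congˡ (-‿inverseˡ 1#) ⟩
      enum i + 0#              ≈⟨ +-identityʳ _ ⟩
      enum i                   ∎)
    unshift-shift : ∀ i → unshift (shift i) ≡ i
    unshift-shift i = enum-inj _ _ (begin
      enum (unshift (shift i)) ≈⟨ index-enum _ ⟩
      enum (shift i) - 1#      ≈⟨ +-congʳ (index-enum _) ⟩
      (1# + enum i) - 1#       ≈⟨ +-congʳ (+-comm _ _) ⟩
      (enum i + 1#) - 1#       ≈⟨ +-assoc _ _ _ ⟩
      enum i + (1# - 1#)       ≈⟨ +-congˡ (-‿inverseʳ 1#) ⟩
      enum i + 0#              ≈⟨ +-identityʳ _ ⟩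
      enum i                   ∎)
    S = sum enum

-- In a commutative ring of prime characteristic p the map x ↦ x^(p^j) is additive
-- (the freshman's dream), because p divides every inner binomial coefficient.
module PrimeCharacteristic {c ℓ : Level} (R : CommutativeRing c ℓ) {p : ℕ} (p-prime : Prime p) where
  open CommutativeRing R
  open import Relation.Binary.Reasoning.Setoid setoid
  open import Algebra.Properties.Semiring.Mult semiring using (×-assocˡ; ×-assoc-*; ×-congʳ) renaming (_×_ to _·_)
  open import Algebra.Properties.CommutativeSemiring.Exp commutativeSemiring using (_^_; ^-congˡ; ^-assocʳ)
  open import Algebra.Properties.CommutativeSemiring.Binomial commutativeSemiring using (theorem; binomialTerm)
  open import Algebra.Properties.CommutativeMonoid.Sum +-commutativeMonoid using (sum; sum-init-last; sum-cong-≋; sum-replicate-zero)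
  open import Data.Nat.Combinatorics using (_C_; nCn≡1)
  open import Data.Nat.Divisibility using (divides)
  import Data.Nat.Properties as ℕ
  import Data.Fin.Properties as Fin
  open BinomialDivisibility using (prime∣binomial)

  module _ (char-p : p · 1# ≈ 0#) where

    multiple-of-p-vanishes : ∀ d x → (d ℕ.* p) · x ≈ 0#
    multiple-of-p-vanishes d x = begin
      (d ℕ.* p) · x        ≡⟨ ≡.cong (_· x) (ℕ.*-comm d p) ⟩
      (p ℕ.* d) · x        ≈⟨ sym (×-assocˡ x p d) ⟩
      p · (d · x)          ≈⟨ ×-congʳ p (sym (*-identityˡ _)) ⟩
      p · (1# * (d · x))   ≈⟨ sym (×-assoc-* p 1# (d · x)) ⟩
      (p · 1#) * (d · x)   ≈⟨ *-congʳ char-p ⟩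
      0# * (d · x)         ≈⟨ zeroˡ _ ⟩
      0#                   ∎

    freshman : ∀ x y → (x + y) ^ p ≈ x ^ p + y ^ p
    freshman = expand p p-prime ≡.refl
      where
      -- a prime is at least 2, so its binomial expansion has a first, a last and inner terms
      expand : ∀ n → Prime n → n ≡ p → ∀ x y → (x + y) ^ n ≈ x ^ n + y ^ n
      expand (suc (suc m)) _ ≡.refl x y = begin
        (x + y) ^ n                                           ≈⟨ theorem n x y ⟩
        binomialTerm x y n Fin.zero + sum inner               ≈⟨ +-cong first (sum-init-last {suc m} inner) ⟩
        y ^ n + (sum (λ j → inner (Fin.inject₁ j)) + inner (Fin.fromℕ (suc m)))
          ≈⟨ +-congˡ (+-cong (trans (sum-cong-≋ {suc m} middle) (sum-replicate-zero (suc m))) (last _ (≡.cong suc (Fin.toℕ-fromℕ (suc m))))) ⟩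
        y ^ n + (0# + x ^ n)                                  ≈⟨ trans (+-congˡ (+-identityˡ _)) (+-comm _ _) ⟩
        x ^ n + y ^ n                                         ∎
        where
        n = suc (suc m)
        inner : Fin (suc (suc m)) → Carrier
        inner j = binomialTerm x y n (Fin.suc j)
        first : binomialTerm x y n Fin.zero ≈ y ^ n
        first = trans (+-identityʳ _) (*-identityˡ _)
        middle : ∀ j → inner (Fin.inject₁ j) ≈ 0#
        middle j with prime∣binomial (Fin.toℕ (Fin.inject₁ j)) p-prime
                        (ℕ.s≤s (≡.subst (ℕ._< suc m) (≡.sym (Fin.toℕ-inject₁ j)) (Fin.toℕ<n j)))
        ... | divides d eq = ≡.subst (λ t → t · monomial ≈ 0#) (≡.sym eq) (multiple-of-p-vanishes d monomial)
          where
          k = suc (Fin.toℕ (Fin.inject₁ j))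
          monomial = x ^ k * y ^ (n ℕ.∸ k)
        last : ∀ t → t ≡ n → (n C t) · (x ^ t * y ^ (n ℕ.∸ t)) ≈ x ^ n
        last t ≡.refl = begin
          (n C n) · (x ^ n * y ^ (n ℕ.∸ n)) ≡⟨ ≡.cong₂ (λ a b → a · (x ^ n * y ^ b)) (nCn≡1 n) (ℕ.n∸n≡0 n) ⟩
          1 · (x ^ n * 1#)                  ≈⟨ +-identityʳ _ ⟩
          x ^ n * 1#                        ≈⟨ *-identityʳ _ ⟩
          x ^ n                             ∎

    ^p^j-additive : ∀ j x y → (x + y) ^ (p ℕ.^ j) ≈ x ^ (p ℕ.^ j) + y ^ (p ℕ.^ j)
    ^p^j-additive zero    x y = trans (*-identityʳ _) (sym (+-cong (*-identityʳ _) (*-identityʳ _)))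
    ^p^j-additive (suc j) x y = begin
      (x + y) ^ (p ℕ.* p ℕ.^ j)               ≈⟨ sym (^-assocʳ (x + y) p (p ℕ.^ j)) ⟩
      ((x + y) ^ p) ^ (p ℕ.^ j)               ≈⟨ ^-congˡ (p ℕ.^ j) (freshman x y) ⟩
      (x ^ p + y ^ p) ^ (p ℕ.^ j)             ≈⟨ ^p^j-additive j (x ^ p) (y ^ p) ⟩
      (x ^ p) ^ (p ℕ.^ j) + (y ^ p) ^ (p ℕ.^ j) ≈⟨ +-cong (^-assocʳ x p (p ℕ.^ j)) (^-assocʳ y p (p ℕ.^ j)) ⟩
      x ^ (p ℕ.* p ℕ.^ j) + y ^ (p ℕ.* p ℕ.^ j) ∎

module Conjugation {c ℓ : Level} (R : CommutativeRing c ℓ) (q : ℕ) (F : IsFiniteField R (q ℕ.* q))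
                   (p k : ℕ) (p-prime : Prime p) (q≡p^k+1 : q ≡ p ℕ.^ suc k) where
  open CommutativeRing R
  open IsFiniteField F using (nontrivial)
  open FiniteField R (q ℕ.* q) F
  open Hermitian R q using (pow; frob; InSubfield)
  open import Relation.Binary.Reasoning.Setoid setoid
  open import Algebra.Properties.Semiring.Mult semiring using (×1-homo-*) renaming (_×_ to _·_)
  open import Algebra.Properties.CommutativeSemiring.Exp commutativeSemiring using (_^_; ^-congˡ; ^-distrib-*)
  open import Algebra.Properties.Group +-group using (inverseʳ-unique; ∙-cancelʳ; x∙y⁻¹≈ε⇒x≈y; x≈y⇒x∙y⁻¹≈ε)
  import Data.Nat.Properties as ℕ

  -- Defs' power function agrees with the library's, whose laws we use
  pow≈^ : ∀ x n → pow x n ≈ x ^ n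
  pow≈^ x zero    = refl
  pow≈^ x (suc n) = *-congˡ (pow≈^ x n)

  ^-zero-divisor : ∀ x n → x ^ n ≈ 0# → x ≈ 0#
  ^-zero-divisor x zero    1≈0 = ⊥-elim (nontrivial 1≈0)
  ^-zero-divisor x (suc n) e with zero-divisor x (x ^ n) e
  ... | inj₁ x≈0   = x≈0
  ... | inj₂ xⁿ≈0 = ^-zero-divisor x n xⁿ≈0

  1^n≈1 : ∀ n → 1# ^ n ≈ 1#
  1^n≈1 zero    = refl
  1^n≈1 (suc n) = trans (*-identityˡ _) (1^n≈1 n)

  ·1-homo-^ : ∀ m n → (m ℕ.^ n) · 1# ≈ (m · 1#) ^ n
  ·1-homo-^ m zero    = +-identityʳ 1#
  ·1-homo-^ m (suc n) = trans (×1-homo-* m (m ℕ.^ n)) (*-congˡ (·1-homo-^ m n))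

  -- R has characteristic p: (p·1)^(2k+2) = (q·q)·1 = 0 and R has no zero divisors
  char-p : p · 1# ≈ 0#
  char-p = ^-zero-divisor (p · 1#) (suc k ℕ.+ suc k) (begin
    (p · 1#) ^ (suc k ℕ.+ suc k)        ≈⟨ sym (·1-homo-^ p (suc k ℕ.+ suc k)) ⟩
    (p ℕ.^ (suc k ℕ.+ suc k)) · 1#      ≡⟨ ≡.cong (_· 1#) (ℕ.^-distribˡ-+-* p (suc k) (suc k)) ⟩
    (p ℕ.^ suc k ℕ.* p ℕ.^ suc k) · 1#  ≡⟨ ≡.cong (_· 1#) (≡.sym (≡.cong₂ ℕ._*_ q≡p^k+1 q≡p^k+1)) ⟩
    (q ℕ.* q) · 1#                      ≈⟨ order-annihilates ⟩
    0#                                  ∎)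

  open PrimeCharacteristic R p-prime using (^p^j-additive)

  frob≈^ : ∀ x → frob x ≈ x ^ (p ℕ.^ suc k)
  frob≈^ x = trans (pow≈^ x q) (≡.subst (λ t → x ^ q ≈ x ^ t) q≡p^k+1 refl)

  frob-cong : ∀ {x y} → x ≈ y → frob x ≈ frob y
  frob-cong {x} {y} x≈y = trans (frob≈^ x) (trans (^-congˡ (p ℕ.^ suc k) x≈y) (sym (frob≈^ y)))

  frob-+ : ∀ x y → frob (x + y) ≈ frob x + frob y
  frob-+ x y = trans (frob≈^ _) (trans (^p^j-additive char-p (suc k) x y) (sym (+-cong (frob≈^ x) (frob≈^ y))))

  frob-* : ∀ x y → frob (x * y) ≈ frob x * frob y
  frob-* x y = trans (frob≈^ _) (trans (^-distrib-* x y (p ℕ.^ suc k)) (sym (*-cong (frob≈^ x) (frob≈^ y))))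

  frob-1 : frob 1# ≈ 1#
  frob-1 = trans (frob≈^ _) (1^n≈1 (p ℕ.^ suc k))

  frob-0 : frob 0# ≈ 0#
  frob-0 = ∙-cancelʳ (frob 0#) _ _ (begin
    frob 0# + frob 0# ≈⟨ sym (frob-+ 0# 0#) ⟩
    frob (0# + 0#)    ≈⟨ frob-cong (+-identityˡ 0#) ⟩
    frob 0#           ≈⟨ sym (+-identityˡ _) ⟩
    0# + frob 0#      ∎)

  frob-neg : ∀ x → frob (- x) ≈ - frob x
  frob-neg x = inverseʳ-unique (frob x) (frob (- x))
    (trans (sym (frob-+ x (- x))) (trans (frob-cong (-‿inverseʳ x)) frob-0))

  frob-- : ∀ x y → frob (x - y) ≈ frob x - frob y
  frob-- x y = trans (frob-+ x (- y)) (+-congˡ (frob-neg y))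

  -- its kernel is trivial, so it is injective
  frob≈0 : ∀ {x} → frob x ≈ 0# → x ≈ 0#
  frob≈0 {x} e = ^-zero-divisor x (p ℕ.^ suc k) (trans (sym (frob≈^ x)) e)

  frob-nonzero : ∀ {x} → ¬ (x ≈ 0#) → ¬ (frob x ≈ 0#)
  frob-nonzero x≉0 e = x≉0 (frob≈0 e)

  frob-injective : ∀ {x y} → frob x ≈ frob y → x ≈ y
  frob-injective {x} {y} e = x∙y⁻¹≈ε⇒x≈y x y (frob≈0 (trans (frob-- x y) (x≈y⇒x∙y⁻¹≈ε e)))

  GF-q-0 : InSubfield 0#
  GF-q-0 = frob-0

  GF-q-1 : InSubfield 1#
  GF-q-1 = frob-1

  GF-q-+ : ∀ {x y} → InSubfield x → InSubfield y → InSubfield (x + y)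
  GF-q-+ x̄≈x ȳ≈y = trans (frob-+ _ _) (+-cong x̄≈x ȳ≈y)

  GF-q-* : ∀ {x y} → InSubfield x → InSubfield y → InSubfield (x * y)
  GF-q-* x̄≈x ȳ≈y = trans (frob-* _ _) (*-cong x̄≈x ȳ≈y)

  GF-q-- : ∀ {x y} → InSubfield x → InSubfield y → InSubfield (x - y)
  GF-q-- x̄≈x ȳ≈y = trans (frob-- _ _) (+-cong x̄≈x (-‿cong ȳ≈y))

  GF-q-inverse : ∀ {x y} → InSubfield x → x * y ≈ 1# → InSubfield y
  GF-q-inverse {x} {y} x̄≈x xy≈1 = *-cancelˡ x≉0 (begin
    x * frob y      ≈⟨ *-congʳ (sym x̄≈x) ⟩
    frob x * frob y ≈⟨ sym (frob-* x y) ⟩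
    frob (x * y)    ≈⟨ frob-cong xy≈1 ⟩
    frob 1#         ≈⟨ frob-1 ⟩
    1#              ≈⟨ sym xy≈1 ⟩
    x * y           ∎)
    where
    x≉0 : ¬ (x ≈ 0#)
    x≉0 x≈0 = nontrivial (trans (sym xy≈1) (trans (*-congʳ x≈0) (zeroˡ y)))

  GF-q-cong : ∀ {x y} → x ≈ y → InSubfield x → InSubfield y
  GF-q-cong x≈y x̄≈x = trans (frob-cong (sym x≈y)) (trans x̄≈x x≈y)

module Vectors3 {c ℓ : Level} (R : CommutativeRing c ℓ) (q : ℕ) where
  open CommutativeRing R
  open Hermitian R q
  open IntegerRingSolver R using (solve; _:+_; _:*_; _:-_; _:=_)
  open import Algebra.Properties.Group +-group using (x∙y⁻¹≈ε⇒x≈y)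

  dot : V3 → V3 → Carrier
  dot a b = a 0F * b 0F + a 1F * b 1F + a 2F * b 2F

  cross : V3 → V3 → V3
  cross a b 0F = a 1F * b 2F - a 2F * b 1F
  cross a b 1F = a 2F * b 0F - a 0F * b 2F
  cross a b 2F = a 0F * b 1F - a 1F * b 0F

  appᵀ : Mat3 → V3 → V3
  appᵀ A y j = A 0F j * y 0F + A 1F j * y 1F + A 2F j * y 2F

  cof : Mat3 → Mat3
  cof A 0F 0F = A 1F 1F * A 2F 2F - A 1F 2F * A 2F 1F
  cof A 0F 1F = A 1F 2F * A 2F 0F - A 1F 0F * A 2F 2F
  cof A 0F 2F = A 1F 0F * A 2F 1F - A 1F 1F * A 2F 0F
  cof A 1F 0F = A 0F 2F * A 2F 1F - A 0F 1F * A 2F 2F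
  cof A 1F 1F = A 0F 0F * A 2F 2F - A 0F 2F * A 2F 0F
  cof A 1F 2F = A 0F 1F * A 2F 0F - A 0F 0F * A 2F 1F
  cof A 2F 0F = A 0F 1F * A 1F 2F - A 0F 2F * A 1F 1F
  cof A 2F 1F = A 0F 2F * A 1F 0F - A 0F 0F * A 1F 2F
  cof A 2F 2F = A 0F 0F * A 1F 1F - A 0F 1F * A 1F 0F

  cross-app : ∀ A x y i → cross (app3 A x) (app3 A y) i ≈ app3 (cof A) (cross x y) i
  cross-app A x y 0F = solve 15 (λ a00 a01 a02 a10 a11 a12 a20 a21 a22 x0 x1 x2 y0 y1 y2 →
      (a10 :* x0 :+ a11 :* x1 :+ a12 :* x2) :* (a20 :* y0 :+ a21 :* y1 :+ a22 :* y2)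
        :- (a20 :* x0 :+ a21 :* x1 :+ a22 :* x2) :* (a10 :* y0 :+ a11 :* y1 :+ a12 :* y2)
    := (a11 :* a22 :- a12 :* a21) :* (x1 :* y2 :- x2 :* y1) :+ (a12 :* a20 :- a10 :* a22) :* (x2 :* y0 :- x0 :* y2)
        :+ (a10 :* a21 :- a11 :* a20) :* (x0 :* y1 :- x1 :* y0))
    refl (A 0F 0F) (A 0F 1F) (A 0F 2F) (A 1F 0F) (A 1F 1F) (A 1F 2F) (A 2F 0F) (A 2F 1F) (A 2F 2F)
         (x 0F) (x 1F) (x 2F) (y 0F) (y 1F) (y 2F)
  cross-app A x y 1F = solve 15 (λ a00 a01 a02 a10 a11 a12 a20 a21 a22 x0 x1 x2 y0 y1 y2 →
      (a20 :* x0 :+ a21 :* x1 :+ a22 :* x2) :* (a00 :* y0 :+ a01 :* y1 :+ a02 :* y2)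
        :- (a00 :* x0 :+ a01 :* x1 :+ a02 :* x2) :* (a20 :* y0 :+ a21 :* y1 :+ a22 :* y2)
    := (a02 :* a21 :- a01 :* a22) :* (x1 :* y2 :- x2 :* y1) :+ (a00 :* a22 :- a02 :* a20) :* (x2 :* y0 :- x0 :* y2)
        :+ (a01 :* a20 :- a00 :* a21) :* (x0 :* y1 :- x1 :* y0))
    refl (A 0F 0F) (A 0F 1F) (A 0F 2F) (A 1F 0F) (A 1F 1F) (A 1F 2F) (A 2F 0F) (A 2F 1F) (A 2F 2F)
         (x 0F) (x 1F) (x 2F) (y 0F) (y 1F) (y 2F)
  cross-app A x y 2F = solve 15 (λ a00 a01 a02 a10 a11 a12 a20 a21 a22 x0 x1 x2 y0 y1 y2 →
      (a00 :* x0 :+ a01 :* x1 :+ a02 :* x2) :* (a10 :* y0 :+ a11 :* y1 :+ a12 :* y2)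
        :- (a10 :* x0 :+ a11 :* x1 :+ a12 :* x2) :* (a00 :* y0 :+ a01 :* y1 :+ a02 :* y2)
    := (a01 :* a12 :- a02 :* a11) :* (x1 :* y2 :- x2 :* y1) :+ (a02 :* a10 :- a00 :* a12) :* (x2 :* y0 :- x0 :* y2)
        :+ (a00 :* a11 :- a01 :* a10) :* (x0 :* y1 :- x1 :* y0))
    refl (A 0F 0F) (A 0F 1F) (A 0F 2F) (A 1F 0F) (A 1F 1F) (A 1F 2F) (A 2F 0F) (A 2F 1F) (A 2F 2F)
         (x 0F) (x 1F) (x 2F) (y 0F) (y 1F) (y 2F)

  cof-appᵀ : ∀ A y i → app3 (cof A) (appᵀ A y) i ≈ det3 A * y i
  cof-appᵀ A y 0F = solve 12 (λ a00 a01 a02 a10 a11 a12 a20 a21 a22 y0 y1 y2 →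
      (a11 :* a22 :- a12 :* a21) :* (a00 :* y0 :+ a10 :* y1 :+ a20 :* y2)
        :+ (a12 :* a20 :- a10 :* a22) :* (a01 :* y0 :+ a11 :* y1 :+ a21 :* y2)
        :+ (a10 :* a21 :- a11 :* a20) :* (a02 :* y0 :+ a12 :* y1 :+ a22 :* y2)
    := (a00 :* (a11 :* a22 :- a12 :* a21) :- a01 :* (a10 :* a22 :- a12 :* a20) :+ a02 :* (a10 :* a21 :- a11 :* a20)) :* y0)
    refl (A 0F 0F) (A 0F 1F) (A 0F 2F) (A 1F 0F) (A 1F 1F) (A 1F 2F) (A 2F 0F) (A 2F 1F) (A 2F 2F)
         (y 0F) (y 1F) (y 2F)
  cof-appᵀ A y 1F = solve 12 (λ a00 a01 a02 a10 a11 a12 a20 a21 a22 y0 y1 y2 →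
      (a02 :* a21 :- a01 :* a22) :* (a00 :* y0 :+ a10 :* y1 :+ a20 :* y2)
        :+ (a00 :* a22 :- a02 :* a20) :* (a01 :* y0 :+ a11 :* y1 :+ a21 :* y2)
        :+ (a01 :* a20 :- a00 :* a21) :* (a02 :* y0 :+ a12 :* y1 :+ a22 :* y2)
    := (a00 :* (a11 :* a22 :- a12 :* a21) :- a01 :* (a10 :* a22 :- a12 :* a20) :+ a02 :* (a10 :* a21 :- a11 :* a20)) :* y1)
    refl (A 0F 0F) (A 0F 1F) (A 0F 2F) (A 1F 0F) (A 1F 1F) (A 1F 2F) (A 2F 0F) (A 2F 1F) (A 2F 2F)
         (y 0F) (y 1F) (y 2F)
  cof-appᵀ A y 2F = solve 12 (λ a00 a01 a02 a10 a11 a12 a20 a21 a22 y0 y1 y2 →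
      (a01 :* a12 :- a02 :* a11) :* (a00 :* y0 :+ a10 :* y1 :+ a20 :* y2)
        :+ (a02 :* a10 :- a00 :* a12) :* (a01 :* y0 :+ a11 :* y1 :+ a21 :* y2)
        :+ (a00 :* a11 :- a01 :* a10) :* (a02 :* y0 :+ a12 :* y1 :+ a22 :* y2)
    := (a00 :* (a11 :* a22 :- a12 :* a21) :- a01 :* (a10 :* a22 :- a12 :* a20) :+ a02 :* (a10 :* a21 :- a11 :* a20)) :* y2)
    refl (A 0F 0F) (A 0F 1F) (A 0F 2F) (A 1F 0F) (A 1F 1F) (A 1F 2F) (A 2F 0F) (A 2F 1F) (A 2F 2F)
         (y 0F) (y 1F) (y 2F)

  cross-cross : ∀ a x y i → cross a (cross x y) i ≈ x i * dot y a - y i * dot x a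
  cross-cross a x y 0F = solve 9 (λ a0 a1 a2 x0 x1 x2 y0 y1 y2 →
      a1 :* (x0 :* y1 :- x1 :* y0) :- a2 :* (x2 :* y0 :- x0 :* y2)
    := x0 :* (y0 :* a0 :+ y1 :* a1 :+ y2 :* a2) :- y0 :* (x0 :* a0 :+ x1 :* a1 :+ x2 :* a2))
    refl (a 0F) (a 1F) (a 2F) (x 0F) (x 1F) (x 2F) (y 0F) (y 1F) (y 2F)
  cross-cross a x y 1F = solve 9 (λ a0 a1 a2 x0 x1 x2 y0 y1 y2 →
      a2 :* (x1 :* y2 :- x2 :* y1) :- a0 :* (x0 :* y1 :- x1 :* y0)
    := x1 :* (y0 :* a0 :+ y1 :* a1 :+ y2 :* a2) :- y1 :* (x0 :* a0 :+ x1 :* a1 :+ x2 :* a2))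
    refl (a 0F) (a 1F) (a 2F) (x 0F) (x 1F) (x 2F) (y 0F) (y 1F) (y 2F)
  cross-cross a x y 2F = solve 9 (λ a0 a1 a2 x0 x1 x2 y0 y1 y2 →
      a0 :* (x2 :* y0 :- x0 :* y2) :- a1 :* (x1 :* y2 :- x2 :* y1)
    := x2 :* (y0 :* a0 :+ y1 :* a1 :+ y2 :* a2) :- y2 :* (x0 :* a0 :+ x1 :* a1 :+ x2 :* a2))
    refl (a 0F) (a 1F) (a 2F) (x 0F) (x 1F) (x 2F) (y 0F) (y 1F) (y 2F)

  cross-shear : ∀ l s p w i → cross (λ j → l * p j) (λ j → s * p j + w j) i ≈ l * cross p w i
  cross-shear l s p w 0F = solve 8 (λ l s p0 p1 p2 w0 w1 w2 →
    (l :* p1) :* (s :* p2 :+ w2) :- (l :* p2) :* (s :* p1 :+ w1) := l :* (p1 :* w2 :- p2 :* w1))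
    refl l s (p 0F) (p 1F) (p 2F) (w 0F) (w 1F) (w 2F)
  cross-shear l s p w 1F = solve 8 (λ l s p0 p1 p2 w0 w1 w2 →
    (l :* p2) :* (s :* p0 :+ w0) :- (l :* p0) :* (s :* p2 :+ w2) := l :* (p2 :* w0 :- p0 :* w2))
    refl l s (p 0F) (p 1F) (p 2F) (w 0F) (w 1F) (w 2F)
  cross-shear l s p w 2F = solve 8 (λ l s p0 p1 p2 w0 w1 w2 →
    (l :* p0) :* (s :* p1 :+ w1) :- (l :* p1) :* (s :* p0 :+ w0) := l :* (p0 :* w1 :- p1 :* w0))
    refl l s (p 0F) (p 1F) (p 2F) (w 0F) (w 1F) (w 2F)

  app3-scal : ∀ A k y i → app3 A (λ j → k * y j) i ≈ k * app3 A y i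
  app3-scal A k y i = solve 7 (λ a0 a1 a2 k y0 y1 y2 →
    a0 :* (k :* y0) :+ a1 :* (k :* y1) :+ a2 :* (k :* y2) := k :* (a0 :* y0 :+ a1 :* y1 :+ a2 :* y2))
    refl (A i 0F) (A i 1F) (A i 2F) k (y 0F) (y 1F) (y 2F)

  app3-+ : ∀ A x y i → app3 A (λ j → x j + y j) i ≈ app3 A x i + app3 A y i
  app3-+ A x y i = solve 9 (λ a0 a1 a2 x0 x1 x2 y0 y1 y2 →
    a0 :* (x0 :+ y0) :+ a1 :* (x1 :+ y1) :+ a2 :* (x2 :+ y2)
      := (a0 :* x0 :+ a1 :* x1 :+ a2 :* x2) :+ (a0 :* y0 :+ a1 :* y1 :+ a2 :* y2))
    refl (A i 0F) (A i 1F) (A i 2F) (x 0F) (x 1F) (x 2F) (y 0F) (y 1F) (y 2F)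

  herm-app : ∀ A x z → herm3 (app3 A x) z ≈ dot x (appᵀ A (λ i → frob (z i)))
  herm-app A x z = solve 15 (λ a00 a01 a02 a10 a11 a12 a20 a21 a22 x0 x1 x2 z0 z1 z2 →
      (a00 :* x0 :+ a01 :* x1 :+ a02 :* x2) :* z0 :+ (a10 :* x0 :+ a11 :* x1 :+ a12 :* x2) :* z1
        :+ (a20 :* x0 :+ a21 :* x1 :+ a22 :* x2) :* z2
    := x0 :* (a00 :* z0 :+ a10 :* z1 :+ a20 :* z2) :+ x1 :* (a01 :* z0 :+ a11 :* z1 :+ a21 :* z2)
        :+ x2 :* (a02 :* z0 :+ a12 :* z1 :+ a22 :* z2))
    refl (A 0F 0F) (A 0F 1F) (A 0F 2F) (A 1F 0F) (A 1F 1F) (A 1F 2F) (A 2F 0F) (A 2F 1F) (A 2F 2F)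
         (x 0F) (x 1F) (x 2F) (frob (z 0F)) (frob (z 1F)) (frob (z 2F))

  app3-cong : ∀ A {y z} → (∀ j → y j ≈ z j) → ∀ i → app3 A y i ≈ app3 A z i
  app3-cong A e i = +-cong (+-cong (*-congˡ (e 0F)) (*-congˡ (e 1F))) (*-congˡ (e 2F))

  cross-cong : ∀ {a a' b b'} → (∀ j → a j ≈ a' j) → (∀ j → b j ≈ b' j) → ∀ i → cross a b i ≈ cross a' b' i
  cross-cong ea eb 0F = +-cong (*-cong (ea 1F) (eb 2F)) (-‿cong (*-cong (ea 2F) (eb 1F)))
  cross-cong ea eb 1F = +-cong (*-cong (ea 2F) (eb 0F)) (-‿cong (*-cong (ea 0F) (eb 2F)))
  cross-cong ea eb 2F = +-cong (*-cong (ea 0F) (eb 1F)) (-‿cong (*-cong (ea 1F) (eb 0F)))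

  cross≈0⇒proportional : ∀ a b → (∀ i → cross a b i ≈ 0#) → ∀ j m → a j * b m ≈ a m * b j
  cross≈0⇒proportional a b e 0F 0F = refl
  cross≈0⇒proportional a b e 1F 1F = refl
  cross≈0⇒proportional a b e 2F 2F = refl
  cross≈0⇒proportional a b e 1F 2F = x∙y⁻¹≈ε⇒x≈y _ _ (e 0F)
  cross≈0⇒proportional a b e 2F 1F = sym (x∙y⁻¹≈ε⇒x≈y _ _ (e 0F))
  cross≈0⇒proportional a b e 2F 0F = x∙y⁻¹≈ε⇒x≈y _ _ (e 1F)
  cross≈0⇒proportional a b e 0F 2F = sym (x∙y⁻¹≈ε⇒x≈y _ _ (e 1F))
  cross≈0⇒proportional a b e 0F 1F = x∙y⁻¹≈ε⇒x≈y _ _ (e 2F)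
  cross≈0⇒proportional a b e 1F 0F = sym (x∙y⁻¹≈ε⇒x≈y _ _ (e 2F))

  MA-cong : ∀ A {X Y} → (∀ i → X i ≈ Y i) → ∀ j → MA A X j ≈ MA A Y j
  MA-cong A e 0F = app3-cong A (λ i → e (inject₁ i)) 0F
  MA-cong A e 1F = app3-cong A (λ i → e (inject₁ i)) 1F
  MA-cong A e 2F = app3-cong A (λ i → e (inject₁ i)) 2F
  MA-cong A e 3F = e 3F

  MA-+ : ∀ A X Y j → MA A (λ i → X i + Y i) j ≈ MA A X j + MA A Y j
  MA-+ A X Y 0F = app3-+ A (first3 X) (first3 Y) 0F
  MA-+ A X Y 1F = app3-+ A (first3 X) (first3 Y) 1F
  MA-+ A X Y 2F = app3-+ A (first3 X) (first3 Y) 2F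
  MA-+ A X Y 3F = refl

module HermitianGeometry {c ℓ : Level} (R : CommutativeRing c ℓ) (q : ℕ) (F : IsFiniteField R (q ℕ.* q))
                         (p k : ℕ) (p-prime : Prime p) (q≡p^k+1 : q ≡ p ℕ.^ suc k) where
  open CommutativeRing R
  open IsFiniteField F using (nontrivial; inverse)
  open FiniteField R (q ℕ.* q) F
  open Conjugation R q F p k p-prime q≡p^k+1
  open Hermitian R q
  open Vectors3 R q
  open IntegerRingSolver R using (solve; _:+_; _:*_; _:-_; _:=_; :-_)
  open import Relation.Binary.Reasoning.Setoid setoid
  open import Algebra.Properties.Group +-group using (x≈y⇒x∙y⁻¹≈ε; ⁻¹-involutive)
  open import Algebra.Properties.Ring ring using (-0#≈0#; +-cancelʳ)

  conj : V3 → V3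
  conj x i = frob (x i)

  x*0≈0 : ∀ {x y} → y ≈ 0# → x * y ≈ 0#
  x*0≈0 {x} y≈0 = trans (*-congˡ y≈0) (zeroʳ x)

  herm3-cong : ∀ {x x' y y'} → (∀ i → x i ≈ x' i) → (∀ i → y i ≈ y' i) → herm3 x y ≈ herm3 x' y'
  herm3-cong ex ey = +-cong (+-cong (*-cong (ex 0F) (frob-cong (ey 0F))) (*-cong (ex 1F) (frob-cong (ey 1F))))
                            (*-cong (ex 2F) (frob-cong (ey 2F)))

  herm3-scalʳ : ∀ x y l → herm3 x (λ i → l * y i) ≈ frob l * herm3 x y
  herm3-scalʳ x y l = begin
    herm3 x (λ i → l * y i)
      ≈⟨ +-cong (+-cong (*-congˡ (frob-* l (y 0F))) (*-congˡ (frob-* l (y 1F)))) (*-congˡ (frob-* l (y 2F))) ⟩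
    x 0F * (l̄ * frob (y 0F)) + x 1F * (l̄ * frob (y 1F)) + x 2F * (l̄ * frob (y 2F))
      ≈⟨ solve 7 (λ L x0 x1 x2 y0 y1 y2 → x0 :* (L :* y0) :+ x1 :* (L :* y1) :+ x2 :* (L :* y2)
                                         := L :* (x0 :* y0 :+ x1 :* y1 :+ x2 :* y2))
                 refl l̄ (x 0F) (x 1F) (x 2F) (frob (y 0F)) (frob (y 1F)) (frob (y 2F)) ⟩
    l̄ * herm3 x y ∎
    where l̄ = frob l

  herm4-π : ∀ x y → x 3F * frob (y 3F) ≈ 0# → herm4 x y ≈ herm3 (first3 x) (first3 y)
  herm4-π x y e = trans (+-congˡ e) (+-identityʳ _)

  common-normal⇒proportional : ∀ a b n → (∀ i → cross a n i ≈ 0#) → (∀ i → cross b n i ≈ 0#) →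
                               ∀ m → ¬ (n m ≈ 0#) → ∀ j l → a j * b l ≈ a l * b j
  common-normal⇒proportional a b n a×n≈0 b×n≈0 m nm≉0 j l = *-cancelˡ (*-nonzero nm≉0 nm≉0) (begin
    (n m * n m) * (a j * b l) ≈⟨ solve 3 (λ N x y → (N :* N) :* (x :* y) := (x :* N) :* (y :* N)) refl (n m) (a j) (b l) ⟩
    (a j * n m) * (b l * n m) ≈⟨ *-cong (a∥n j m) (b∥n l m) ⟩
    (a m * n j) * (b m * n l) ≈⟨ solve 4 (λ x y z w → (x :* y) :* (z :* w) := (x :* w) :* (z :* y)) refl (a m) (n j) (b m) (n l) ⟩
    (a m * n l) * (b m * n j) ≈⟨ sym (*-cong (a∥n l m) (b∥n j m)) ⟩
    (a l * n m) * (b j * n m) ≈⟨ solve 3 (λ N x y → (x :* N) :* (y :* N) := (N :* N) :* (x :* y)) refl (n m) (a l) (b j) ⟩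
    (n m * n m) * (a l * b j) ∎)
    where
    a∥n = cross≈0⇒proportional a n a×n≈0
    b∥n = cross≈0⇒proportional b n b×n≈0

  -- The Hermitian plane contains no totally isotropic line: two vectors spanning a
  -- totally isotropic subspace are proportional.  (x̄ and ȳ are both orthogonal to
  -- n = x × y, so if n ≠ 0 then x̄ ∥ ȳ, hence x ∥ y and n = 0 after all.)
  isotropic-pair-proportional : ∀ x y → herm3 x x ≈ 0# → herm3 x y ≈ 0# → herm3 y x ≈ 0# → herm3 y y ≈ 0# →
                                ∀ i → cross x y i ≈ 0#
  isotropic-pair-proportional x y xx yx xy yy m with cross x y m ≟ 0#
  ... | yes nm≈0 = nm≈0
  ... | no nm≉0  = ⊥-elim (nm≉0 (cross≈0 m))
    where
    difference≈0 : ∀ {a b X Y} → X ≈ 0# → Y ≈ 0# → a * X - b * Y ≈ 0#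
    difference≈0 X≈0 Y≈0 = trans (+-cong (x*0≈0 X≈0) (-‿cong (x*0≈0 Y≈0))) (trans (+-identityˡ _) -0#≈0#)
    x̄×n≈0 : ∀ i → cross (conj x) (cross x y) i ≈ 0#
    x̄×n≈0 i = trans (cross-cross (conj x) x y i) (difference≈0 xy xx)
    ȳ×n≈0 : ∀ i → cross (conj y) (cross x y) i ≈ 0#
    ȳ×n≈0 i = trans (cross-cross (conj y) x y i) (difference≈0 yy yx)
    x∥y : ∀ j l → x j * y l ≈ x l * y j
    x∥y j l = frob-injective (trans (frob-* _ _)
      (trans (common-normal⇒proportional (conj x) (conj y) (cross x y) x̄×n≈0 ȳ×n≈0 m nm≉0 j l) (sym (frob-* _ _))))
    cross≈0 : ∀ i → cross x y i ≈ 0#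
    cross≈0 0F = x≈y⇒x∙y⁻¹≈ε (x∥y 1F 2F)
    cross≈0 1F = x≈y⇒x∙y⁻¹≈ε (x∥y 2F 0F)
    cross≈0 2F = x≈y⇒x∙y⁻¹≈ε (x∥y 0F 1F)

  span-isotropic : ∀ {u v} → TotallyIsotropic u v → ∀ x y a b a' b' →
                   (∀ i → x i ≈ lin a u b v i) → (∀ i → y i ≈ lin a' u b' v i) → herm4 x y ≈ 0#
  span-isotropic tiso x y a b a' b' ex ey =
    trans (+-cong (+-cong (+-cong (*-cong (ex 0F) (frob-cong (ey 0F))) (*-cong (ex 1F) (frob-cong (ey 1F))))
                          (*-cong (ex 2F) (frob-cong (ey 2F))))
                  (*-cong (ex 3F) (frob-cong (ey 3F))))
          (tiso a b a' b')

  lin-1-0 : ∀ u v i → u i ≈ lin 1# u 0# v i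
  lin-1-0 u v i = sym (trans (+-cong (*-identityˡ _) (zeroˡ _)) (+-identityʳ _))

  lin-0-1 : ∀ u v i → v i ≈ lin 0# u 1# v i
  lin-0-1 u v i = sym (trans (+-cong (zeroˡ _) (*-identityˡ _)) (+-identityˡ _))

  -- A generator of H(3,q²) is not contained in π, since π ∩ H(3,q²) is a Hermitian
  -- curve, which contains no line.
  generator-leaves-π : ∀ u v → Generator u v → ¬ ((u 3F ≈ 0#) × (v 3F ≈ 0#))
  generator-leaves-π u v (ind , tiso) (u₃≈0 , v₃≈0) = u'm≉0 u'm≈0
    where
    u' = first3 u
    v' = first3 v
    h : ∀ x y {a b a' b'} → x 3F ≈ 0# → (∀ i → x i ≈ lin a u b v i) → (∀ i → y i ≈ lin a' u b' v i) →
        herm3 (first3 x) (first3 y) ≈ 0#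
    h x y x₃≈0 ex ey = trans (sym (herm4-π x y (trans (*-congʳ x₃≈0) (zeroˡ _)))) (span-isotropic tiso x y _ _ _ _ ex ey)
    u'×v'≈0 : ∀ i → cross u' v' i ≈ 0#
    u'×v'≈0 = isotropic-pair-proportional u' v'
      (h u u u₃≈0 (lin-1-0 u v) (lin-1-0 u v)) (h u v u₃≈0 (lin-1-0 u v) (lin-0-1 u v))
      (h v u v₃≈0 (lin-0-1 u v) (lin-1-0 u v)) (h v v v₃≈0 (lin-0-1 u v) (lin-0-1 u v))
    u'≉0 : ¬ (∀ i → u' i ≈ 0#)
    u'≉0 u'≈0 = nontrivial (proj₁ (ind 1# 0# λ
      { 0F → trans (sym (lin-1-0 u v 0F)) (u'≈0 0F) ; 1F → trans (sym (lin-1-0 u v 1F)) (u'≈0 1F)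
      ; 2F → trans (sym (lin-1-0 u v 2F)) (u'≈0 2F) ; 3F → trans (sym (lin-1-0 u v 3F)) u₃≈0 }))
    m = proj₁ (nonzero-coordinate u' u'≉0)
    u'm≉0 = proj₂ (nonzero-coordinate u' u'≉0)
    -- v'_m u − u'_m v = 0, contradicting independence
    dependence-in-π : ∀ j → v' m * u' j + - u' m * v' j ≈ 0#
    dependence-in-π j = trans (solve 4 (λ a b c d → a :* b :+ (:- c) :* d := b :* a :- c :* d) refl (v' m) (u' j) (u' m) (v' j))
                   (x≈y⇒x∙y⁻¹≈ε (cross≈0⇒proportional u' v' u'×v'≈0 j m))
    dependence : ∀ i → lin (v' m) u (- u' m) v i ≈ 0#
    dependence 0F = dependence-in-π 0F
    dependence 1F = dependence-in-π 1F
    dependence 2F = dependence-in-π 2F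
    dependence 3F = trans (+-cong (x*0≈0 u₃≈0) (x*0≈0 v₃≈0)) (+-identityʳ 0#)
    u'm≈0 : u' m ≈ 0#
    u'm≈0 = trans (sym (⁻¹-involutive _)) (trans (-‿cong (proj₂ (ind (v' m) (- u' m) dependence))) -0#≈0#)

  proportional-to-isotropic : ∀ p w → (∀ i → cross p w i ≈ 0#) → herm3 p p ≈ 0# →
                              ∀ m → ¬ (p m ≈ 0#) → herm3 w w ≈ 0#
  proportional-to-isotropic p w p×w≈0 pp≈0 m pm≉0 = *-cancelʳ (*-nonzero pm≉0 (frob-nonzero pm≉0)) (begin
    herm3 w w * N
      ≈⟨ solve 7 (λ a b c d e f X → (a :* b :+ c :* d :+ e :* f) :* X := a :* b :* X :+ c :* d :* X :+ e :* f :* X)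
                 refl (w 0F) (frob (w 0F)) (w 1F) (frob (w 1F)) (w 2F) (frob (w 2F)) N ⟩
    w 0F * frob (w 0F) * N + w 1F * frob (w 1F) * N + w 2F * frob (w 2F) * N
      ≈⟨ +-cong (+-cong (swap 0F) (swap 1F)) (swap 2F) ⟩
    M * (p 0F * frob (p 0F)) + M * (p 1F * frob (p 1F)) + M * (p 2F * frob (p 2F))
      ≈⟨ solve 7 (λ W a b c d e f → W :* (a :* b) :+ W :* (c :* d) :+ W :* (e :* f) := W :* (a :* b :+ c :* d :+ e :* f))
                 refl M (p 0F) (frob (p 0F)) (p 1F) (frob (p 1F)) (p 2F) (frob (p 2F)) ⟩
    M * herm3 p p ≈⟨ x*0≈0 pp≈0 ⟩
    0#            ≈⟨ sym (zeroˡ _) ⟩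
    0# * N        ∎)
    where
    N = p m * frob (p m)
    M = w m * frob (w m)
    -- w_j p_m = w_m p_j, hence (w_j w̄_j)(p_m p̄_m) = (w_m w̄_m)(p_j p̄_j)
    swap : ∀ j → w j * frob (w j) * N ≈ M * (p j * frob (p j))
    swap j = begin
      w j * frob (w j) * N                 ≈⟨ solve 4 (λ a b c d → (a :* b) :* (c :* d) := (a :* c) :* (b :* d)) refl (w j) (frob (w j)) (p m) (frob (p m)) ⟩
      (w j * p m) * (frob (w j) * frob (p m)) ≈⟨ *-congˡ (sym (frob-* _ _)) ⟩
      (w j * p m) * frob (w j * p m)       ≈⟨ *-cong wp (frob-cong wp) ⟩
      (w m * p j) * frob (w m * p j)       ≈⟨ *-congˡ (frob-* _ _) ⟩
      (w m * p j) * (frob (w m) * frob (p j)) ≈⟨ solve 4 (λ a b c d → (a :* b) :* (c :* d) := (a :* c) :* (b :* d)) refl (w m) (p j) (frob (w m)) (frob (p j)) ⟩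
      M * (p j * frob (p j))               ∎
      where
      wp : w j * p m ≈ w m * p j
      wp = trans (*-comm _ _) (trans (sym (cross≈0⇒proportional p w p×w≈0 j m)) (*-comm _ _))

  e : Fin 3 → V3
  e 0F 0F = 1#
  e 1F 1F = 1#
  e 2F 2F = 1#
  e _  _  = 0#

  dot-e : ∀ j z → dot (e j) z ≈ z j
  dot-e 0F z = trans (+-cong (+-cong (*-identityˡ _) (zeroˡ _)) (zeroˡ _)) (trans (+-identityʳ _) (+-identityʳ _))
  dot-e 1F z = trans (+-cong (+-cong (zeroˡ _) (*-identityˡ _)) (zeroˡ _)) (trans (+-identityʳ _) (+-identityˡ _))
  dot-e 2F z = trans (+-cong (+-cong (zeroˡ _) (zeroˡ _)) (*-identityˡ _)) (trans (+-congʳ (+-identityʳ _)) (+-identityˡ _))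

  -- Let A be unitary, p ≠ 0 isotropic with Ap = λp, and w ⊥ p with
  -- Aw = sp + w and n = p × w ≠ 0.  Then cof(A) n = λ n (cofactors transform cross
  -- products), while unitarity gives λ̄ Aᵀp̄ = p̄ and hence cof(A) p̄ = λ̄ det(A) p̄ by
  -- Cramer's rule.  As p̄ ∥ n, comparing the two eigenvalues yields λ = λ̄ det(A).
  unitary-shear-det : ∀ A (p w : V3) (l s : Carrier) → IsGU3 A →
                      (∀ j → app3 A p j ≈ l * p j) → (∀ j → app3 A w j ≈ s * p j + w j) →
                      herm3 p p ≈ 0# → herm3 w p ≈ 0# →
                      ¬ (∀ i → p i ≈ 0#) → ¬ (∀ i → cross p w i ≈ 0#) → l ≈ frob l * det3 A
  unitary-shear-det A p w l s unitary Ap Aw pp≈0 wp≈0 p≉0 n≉0 =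
    *-cancelˡ (*-nonzero p̄m≉0 nm≉0) (begin
      (p̄ m * n m) * l               ≈⟨ solve 3 (λ a b l → (a :* b) :* l := a :* (l :* b)) refl (p̄ m) (n m) l ⟩
      p̄ m * (l * n m)               ≈⟨ *-congˡ (sym (cof-n m)) ⟩
      p̄ m * app3 (cof A) n m        ≈⟨ sym (app3-scal (cof A) (p̄ m) n m) ⟩
      app3 (cof A) (λ j → p̄ m * n j) m ≈⟨ app3-cong (cof A) (λ j → trans (sym (p̄∥n j)) (*-comm _ _)) m ⟩
      app3 (cof A) (λ j → n m * p̄ j) m ≈⟨ app3-scal (cof A) (n m) p̄ m ⟩
      n m * app3 (cof A) p̄ m        ≈⟨ *-congˡ (cof-p̄ m) ⟩
      n m * (frob l * (det3 A * p̄ m)) ≈⟨ solve 4 (λ a b l D → b :* (l :* (D :* a)) := (a :* b) :* (l :* D)) refl (p̄ m) (n m) (frob l) (det3 A) ⟩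
      (p̄ m * n m) * (frob l * det3 A) ∎)
    where
    p̄ = conj p
    n = cross p w
    m = proj₁ (nonzero-coordinate p p≉0)
    pm≉0 = proj₂ (nonzero-coordinate p p≉0)
    p̄m≉0 : ¬ (p̄ m ≈ 0#)
    p̄m≉0 = frob-nonzero pm≉0
    -- p̄ × n = ⟨w,p⟩ p − ⟨p,p⟩ w = 0
    p̄∥n : ∀ j → p̄ j * n m ≈ p̄ m * n j
    p̄∥n = λ j → cross≈0⇒proportional p̄ n (λ i → trans (cross-cross p̄ p w i)
      (trans (+-cong (x*0≈0 wp≈0) (-‿cong (x*0≈0 pp≈0))) (trans (+-identityˡ _) -0#≈0#))) j m
    nm≉0 : ¬ (n m ≈ 0#)
    nm≉0 nm≈0 = n≉0 λ j → *-cancelˡ p̄m≉0 (trans (sym (p̄∥n j)) (trans (x*0≈0 nm≈0) (sym (zeroʳ _))))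
    cof-n : ∀ i → app3 (cof A) n i ≈ l * n i
    cof-n i = begin
      app3 (cof A) (cross p w) i                             ≈⟨ sym (cross-app A p w i) ⟩
      cross (app3 A p) (app3 A w) i                          ≈⟨ cross-cong Ap Aw i ⟩
      cross (λ j → l * p j) (λ j → s * p j + w j) i          ≈⟨ cross-shear l s p w i ⟩
      l * n i                                                ∎
    -- ⟨A e_j, A p⟩ = ⟨e_j, p⟩ reads λ̄ (Aᵀ p̄)_j = p̄_j
    Aᵀp̄ : ∀ j → frob l * appᵀ A p̄ j ≈ p̄ j
    Aᵀp̄ j = begin
      frob l * appᵀ A p̄ j                 ≈⟨ *-congˡ (sym (dot-e j (appᵀ A p̄))) ⟩
      frob l * dot (e j) (appᵀ A p̄)       ≈⟨ *-congˡ (sym (herm-app A (e j) p)) ⟩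
      frob l * herm3 (app3 A (e j)) p      ≈⟨ sym (herm3-scalʳ (app3 A (e j)) p l) ⟩
      herm3 (app3 A (e j)) (λ i → l * p i) ≈⟨ sym (herm3-cong {x = app3 A (e j)} (λ i → refl) Ap) ⟩
      herm3 (app3 A (e j)) (app3 A p)      ≈⟨ unitary (e j) p ⟩
      herm3 (e j) p                        ≈⟨ dot-e j p̄ ⟩
      p̄ j                                  ∎
    cof-p̄ : ∀ i → app3 (cof A) p̄ i ≈ frob l * (det3 A * p̄ i)
    cof-p̄ i = begin
      app3 (cof A) p̄ i                           ≈⟨ app3-cong (cof A) (λ j → sym (Aᵀp̄ j)) i ⟩
      app3 (cof A) (λ j → frob l * appᵀ A p̄ j) i ≈⟨ app3-scal (cof A) (frob l) (appᵀ A p̄) i ⟩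
      frob l * app3 (cof A) (appᵀ A p̄) i         ≈⟨ *-congˡ (cof-appᵀ A p̄ i) ⟩
      frob l * (det3 A * p̄ i)                    ∎

  baer-point : ∀ {u v} α β → InSubfield α → InSubfield β → ¬ (∀ i → lin α u β v i ≈ 0#) → InBaer u v (lin α u β v)
  baer-point α β α∈ β∈ X≉0 = X≉0 , α , β , α∈ , β∈ , not-both-zero , 1# , (λ i → sym (*-identityˡ _))
    where
    not-both-zero : ¬ ((α ≈ 0#) × (β ≈ 0#))
    not-both-zero (α≈0 , β≈0) = X≉0 λ i →
      trans (+-cong (trans (*-congʳ α≈0) (zeroˡ _)) (trans (*-congʳ β≈0) (zeroˡ _))) (+-identityʳ _)

  off-π⇒nonzero : ∀ (X : V4) → ¬ (X 3F ≈ 0#) → ¬ (∀ i → X i ≈ 0#)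
  off-π⇒nonzero X X₃≉0 X≈0 = X₃≉0 (X≈0 3F)

  restrict : ∀ A X (Z : V4) → (∀ i → MA A X i ≈ Z i) → ∀ j → app3 A (first3 X) j ≈ first3 Z j
  restrict A X Z e 0F = e 0F
  restrict A X Z e 1F = e 1F
  restrict A X Z e 2F = e 2F

  -- Coordinates on the Baer subline b of ⟨u,v⟩ adapted to π: P = au + bv is a point of
  -- b in π and Q = a'u + b'v one off π, with a, b, a', b' ∈ GF(q).  Since the change of
  -- basis (u,v) ↦ (P,Q) is defined over GF(q), b consists of the points ⟨ξP + ηQ⟩ with
  -- ξ, η ∈ GF(q); in particular ⟨P⟩ is the only point of b in π.
  module BaerFrame (u v : V4) (gen : Generator u v)
                   (a b a' b' : Carrier) (a∈ : InSubfield a) (b∈ : InSubfield b)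
                   (a'∈ : InSubfield a') (b'∈ : InSubfield b')
                   (P₃≈0 : lin a u b v 3F ≈ 0#) (P≉0 : ¬ (∀ i → lin a u b v i ≈ 0#))
                   (Q₃≉0 : ¬ (lin a' u b' v 3F ≈ 0#)) where
    P Q : V4
    P = lin a u b v
    Q = lin a' u b' v

    iP = proj₁ (nonzero-coordinate P P≉0)
    P-iP≉0 = proj₂ (nonzero-coordinate P P≉0)

    P-coefficient-unique : ∀ {σ τ} → (∀ i → σ * P i ≈ τ * P i) → σ ≈ τ
    P-coefficient-unique e = *-cancelʳ P-iP≉0 (e iP)

    P-Q-independent : ∀ α β → (∀ i → α * P i + β * Q i ≈ 0#) → (α ≈ 0#) × (β ≈ 0#)
    P-Q-independent α β e = α≈0 , β≈0
      where
      β≈0 : β ≈ 0#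
      β≈0 = *-cancelʳ Q₃≉0 (trans (sym (trans (+-congʳ (x*0≈0 P₃≈0)) (+-identityˡ _))) (trans (e 3F) (sym (zeroˡ _))))
      α≈0 : α ≈ 0#
      α≈0 = P-coefficient-unique (λ i →
        trans (sym (trans (+-congˡ (trans (*-congʳ β≈0) (zeroˡ _))) (+-identityʳ _))) (trans (e i) (sym (zeroˡ _))))

    -- the determinant of the change of basis
    D = a * b' - b * a'

    D≉0 : ¬ (D ≈ 0#)
    D≉0 D≈0 = P≉0 λ i → trans (+-cong (trans (*-congʳ a≈0) (zeroˡ _)) (trans (*-congʳ b≈0) (zeroˡ _))) (+-identityʳ _)
      where
      -- b'P − bQ = Du and −a'P + aQ = Dv both vanish
      Du : ∀ i → b' * P i + (- b) * Q i ≈ 0#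
      Du i = trans (solve 6 (λ a b a' b' u v → b' :* (a :* u :+ b :* v) :+ (:- b) :* (a' :* u :+ b' :* v) := (a :* b' :- b :* a') :* u)
                     refl a b a' b' (u i) (v i)) (trans (*-congʳ D≈0) (zeroˡ _))
      Dv : ∀ i → (- a') * P i + a * Q i ≈ 0#
      Dv i = trans (solve 6 (λ a b a' b' u v → (:- a') :* (a :* u :+ b :* v) :+ a :* (a' :* u :+ b' :* v) := (a :* b' :- b :* a') :* v)
                     refl a b a' b' (u i) (v i)) (trans (*-congʳ D≈0) (zeroˡ _))
      b≈0 : b ≈ 0#
      b≈0 = trans (sym (⁻¹-involutive b)) (trans (-‿cong (proj₂ (P-Q-independent b' (- b) Du))) -0#≈0#)
      a≈0 : a ≈ 0#
      a≈0 = proj₂ (P-Q-independent (- a') a Dv)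

    D⁻¹ = proj₁ (inverse D D≉0)
    DD⁻¹≈1 : D * D⁻¹ ≈ 1#
    DD⁻¹≈1 = proj₂ (inverse D D≉0)
    D⁻¹∈ : InSubfield D⁻¹
    D⁻¹∈ = GF-q-inverse (GF-q-- (GF-q-* a∈ b'∈) (GF-q-* b∈ a'∈)) DD⁻¹≈1

    -- αu + βv = ξP + ηQ with ξ, η ∈ GF(q), by inverting the GF(q)-matrix of (P,Q)
    change-of-basis : ∀ α β → InSubfield α → InSubfield β →
                      Σ Carrier λ ξ → Σ Carrier λ η → InSubfield ξ × InSubfield η ×
                      (∀ i → lin α u β v i ≈ ξ * P i + η * Q i)
    change-of-basis α β α∈ β∈ =
      ξ , η , GF-q-* (GF-q-- (GF-q-* α∈ b'∈) (GF-q-* β∈ a'∈)) D⁻¹∈ , GF-q-* (GF-q-- (GF-q-* β∈ a∈) (GF-q-* α∈ b∈)) D⁻¹∈ , expand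
      where
      ξ = (α * b' - β * a') * D⁻¹
      η = (β * a - α * b) * D⁻¹
      expand : ∀ i → lin α u β v i ≈ ξ * P i + η * Q i
      expand i = sym (begin
        ξ * P i + η * Q i
          ≈⟨ solve 9 (λ α β a b a' b' u v E → ((α :* b' :- β :* a') :* E) :* (a :* u :+ b :* v) :+ ((β :* a :- α :* b) :* E) :* (a' :* u :+ b' :* v)
                                              := (α :* u :+ β :* v) :* ((a :* b' :- b :* a') :* E))
                     refl α β a b a' b' (u i) (v i) D⁻¹ ⟩
        lin α u β v i * (D * D⁻¹) ≈⟨ *-congˡ DD⁻¹≈1 ⟩
        lin α u β v i * 1#        ≈⟨ *-identityʳ _ ⟩
        lin α u β v i             ∎)

    baer-coordinates : ∀ Y → InBaer u v Y → Σ Carrier λ κ → Σ Carrier λ ξ → Σ Carrier λ η →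
                       ¬ (κ ≈ 0#) × InSubfield ξ × InSubfield η × (∀ i → Y i ≈ κ * (ξ * P i + η * Q i))
    baer-coordinates Y (Y≉0 , α , β , α∈ , β∈ , _ , κ , Y≈κX) = κ , ξ , η , κ≉0 , ξ∈ , η∈ , Y≈
      where
      new = change-of-basis α β α∈ β∈
      ξ = proj₁ new
      η = proj₁ (proj₂ new)
      ξ∈ = proj₁ (proj₂ (proj₂ new))
      η∈ = proj₁ (proj₂ (proj₂ (proj₂ new)))
      Y≈ : ∀ i → Y i ≈ κ * (ξ * P i + η * Q i)
      Y≈ i = trans (Y≈κX i) (*-congˡ (proj₂ (proj₂ (proj₂ (proj₂ new))) i))
      κ≉0 : ¬ (κ ≈ 0#)
      κ≉0 κ≈0 = Y≉0 (λ i → trans (Y≈κX i) (trans (*-congʳ κ≈0) (zeroˡ _)))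

    -- only Q contributes to the last coordinate
    third-coordinate : ∀ {Y : V4} {κ ξ η : Carrier} → (∀ i → Y i ≈ κ * (ξ * P i + η * Q i)) → Y 3F ≈ (κ * η) * Q 3F
    third-coordinate {Y} {κ} {ξ} {η} e = begin
      Y 3F                          ≈⟨ e 3F ⟩
      κ * (ξ * P 3F + η * Q 3F)     ≈⟨ *-congˡ (trans (+-congʳ (x*0≈0 P₃≈0)) (+-identityˡ _)) ⟩
      κ * (η * Q 3F)                ≈⟨ sym (*-assoc _ _ _) ⟩
      (κ * η) * Q 3F                ∎

    baer-point-in-π : ∀ Y → InBaer u v Y → Y 3F ≈ 0# → Σ Carrier λ μ → ¬ (μ ≈ 0#) × (∀ i → Y i ≈ μ * P i)
    baer-point-in-π Y Y∈b Y₃≈0 = κ * ξ , μ≉0 , Y≈μP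
      where
      coordinates = baer-coordinates Y Y∈b
      κ = proj₁ coordinates
      ξ = proj₁ (proj₂ coordinates)
      η = proj₁ (proj₂ (proj₂ coordinates))
      κ≉0 = proj₁ (proj₂ (proj₂ (proj₂ coordinates)))
      Y≈ = proj₂ (proj₂ (proj₂ (proj₂ (proj₂ (proj₂ coordinates)))))
      η≈0 : η ≈ 0#
      η≈0 = *-cancelˡ κ≉0 (*-cancelʳ Q₃≉0
        (trans (sym (third-coordinate Y≈)) (trans Y₃≈0 (trans (sym (zeroˡ _)) (*-congʳ (sym (zeroʳ κ)))))))
      Y≈μP : ∀ i → Y i ≈ κ * ξ * P i
      Y≈μP i = begin
        Y i                         ≈⟨ Y≈ i ⟩
        κ * (ξ * P i + η * Q i)     ≈⟨ *-congˡ (trans (+-congˡ (trans (*-congʳ η≈0) (zeroˡ _))) (+-identityʳ _)) ⟩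
        κ * (ξ * P i)               ≈⟨ sym (*-assoc _ _ _) ⟩
        κ * ξ * P i                 ∎
      μ≉0 : ¬ (κ * ξ ≈ 0#)
      μ≉0 μ≈0 = proj₁ Y∈b (λ i → trans (Y≈μP i) (trans (*-congʳ μ≈0) (zeroˡ _)))

    baer-point-level-Q : ∀ Y → InBaer u v Y → Y 3F ≈ Q 3F → Σ Carrier λ σ → InSubfield σ × (∀ i → Y i ≈ σ * P i + Q i)
    baer-point-level-Q Y Y∈b Y₃≈Q₃ = κ * ξ , GF-q-* κ∈ ξ∈ , Y≈σP+Q
      where
      coordinates = baer-coordinates Y Y∈b
      κ = proj₁ coordinates
      ξ = proj₁ (proj₂ coordinates)
      η = proj₁ (proj₂ (proj₂ coordinates))
      ξ∈ = proj₁ (proj₂ (proj₂ (proj₂ (proj₂ coordinates))))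
      η∈ = proj₁ (proj₂ (proj₂ (proj₂ (proj₂ (proj₂ coordinates)))))
      Y≈ = proj₂ (proj₂ (proj₂ (proj₂ (proj₂ (proj₂ coordinates)))))
      κη≈1 : κ * η ≈ 1#
      κη≈1 = *-cancelʳ Q₃≉0 (trans (sym (third-coordinate Y≈)) (trans Y₃≈Q₃ (sym (*-identityˡ _))))
      κ∈ : InSubfield κ
      κ∈ = GF-q-inverse η∈ (trans (*-comm η κ) κη≈1)
      Y≈σP+Q : ∀ i → Y i ≈ κ * ξ * P i + Q i
      Y≈σP+Q i = begin
        Y i                           ≈⟨ Y≈ i ⟩
        κ * (ξ * P i + η * Q i)       ≈⟨ solve 5 (λ k x y P Q → k :* (x :* P :+ y :* Q) := k :* x :* P :+ (k :* y) :* Q) refl κ ξ η (P i) (Q i) ⟩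
        κ * ξ * P i + (κ * η) * Q i   ≈⟨ +-congˡ (trans (*-congʳ κη≈1) (*-identityˡ _)) ⟩
        κ * ξ * P i + Q i             ∎

    P∈b : InBaer u v P
    P∈b = baer-point a b a∈ b∈ P≉0

    Q∈b : InBaer u v Q
    Q∈b = baer-point a' b' a'∈ b'∈ (off-π⇒nonzero Q Q₃≉0)

    -- An element M_A of G_O preserving b fixes ⟨P⟩ (the only point of b in π) and acts
    -- on the affine part of b by a translation; both parameters lie in GF(q).
    module Stabiliser (A : Mat3) (unitary : IsGU3 A) (preserves : ∀ x → InBaer u v x → InBaer u v (MA A x)) where

      -- M_A preserves π, so it maps P to a point of b in π, i.e. to a multiple of P
      eigenvalue : Σ Carrier λ l → ¬ (l ≈ 0#) × (∀ i → MA A P i ≈ l * P i)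
      eigenvalue = baer-point-in-π (MA A P) (preserves P P∈b) P₃≈0

      l = proj₁ eigenvalue
      l≉0 = proj₁ (proj₂ eigenvalue)
      MP≈lP = proj₂ (proj₂ eigenvalue)

      -- M_A fixes the last coordinate, so M_A Q is a point of b of the form sP + Q
      translation : Σ Carrier λ s → InSubfield s × (∀ i → MA A Q i ≈ s * P i + Q i)
      translation = baer-point-level-Q (MA A Q) (preserves Q Q∈b) refl

      s = proj₁ translation
      s∈ = proj₁ (proj₂ translation)
      MQ≈sP+Q = proj₂ (proj₂ translation)

      -- M_A maps Q + P ∈ b to (s + λ)P + Q, which must again have a GF(q)-coefficient
      eigenvalue∈GF-q : InSubfield l
      eigenvalue∈GF-q = GF-q-cong σ-s≈l (GF-q-- σ∈ s∈)
        where
        Y = lin (a' + a) u (b' + b) v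
        Y≈Q+P : ∀ i → Y i ≈ Q i + P i
        Y≈Q+P i = solve 6 (λ a' a b' b u v → (a' :+ a) :* u :+ (b' :+ b) :* v := (a' :* u :+ b' :* v) :+ (a :* u :+ b :* v))
                          refl a' a b' b (u i) (v i)
        Y₃≉0 : ¬ (Y 3F ≈ 0#)
        Y₃≉0 Y₃≈0 = Q₃≉0 (trans (sym (trans (+-congˡ P₃≈0) (+-identityʳ _))) (trans (sym (Y≈Q+P 3F)) Y₃≈0))
        MY : ∀ i → MA A Y i ≈ (s + l) * P i + Q i
        MY i = begin
          MA A Y i                       ≈⟨ MA-cong A Y≈Q+P i ⟩
          MA A (λ j → Q j + P j) i       ≈⟨ MA-+ A Q P i ⟩
          MA A Q i + MA A P i            ≈⟨ +-cong (MQ≈sP+Q i) (MP≈lP i) ⟩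
          (s * P i + Q i) + l * P i      ≈⟨ solve 4 (λ s P Q l → (s :* P :+ Q) :+ l :* P := (s :+ l) :* P :+ Q) refl s (P i) (Q i) l ⟩
          (s + l) * P i + Q i            ∎
        MY∈b = preserves Y (baer-point (a' + a) (b' + b) (GF-q-+ a'∈ a∈) (GF-q-+ b'∈ b∈) (off-π⇒nonzero Y Y₃≉0))
        level-Q = baer-point-level-Q (MA A Y) MY∈b (trans (MY 3F) (trans (+-congʳ (x*0≈0 P₃≈0)) (+-identityˡ _)))
        σ = proj₁ level-Q
        σ∈ = proj₁ (proj₂ level-Q)
        s+l≈σ : s + l ≈ σ
        s+l≈σ = P-coefficient-unique (λ i → +-cancelʳ (Q i) _ _ (trans (sym (MY i)) (proj₂ (proj₂ level-Q) i)))
        σ-s≈l : σ - s ≈ l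
        σ-s≈l = trans (+-congʳ (sym s+l≈σ)) (solve 2 (λ s l → (s :+ l) :- s := l) refl s l)

      -- the restriction of M_A to π satisfies the hypotheses of unitary-shear-det with
      -- p = P', w = Q'; then λ = λ̄ det A = λ det A with λ ≠ 0
      det≈1 : det3 A ≈ 1#
      det≈1 = sym (*-cancelˡ l≉0 (begin
        l * 1#          ≈⟨ *-identityʳ l ⟩
        l               ≈⟨ unitary-shear-det A P' Q' l s unitary (restrict A P _ MP≈lP) (restrict A Q _ MQ≈sP+Q) P'P'≈0 Q'P'≈0 P'≉0 n≉0 ⟩
        frob l * det3 A ≈⟨ *-congʳ eigenvalue∈GF-q ⟩
        l * det3 A      ∎))
        where
        tiso = proj₂ gen
        P' = first3 P
        Q' = first3 Q
        P'P'≈0 : herm3 P' P' ≈ 0#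
        P'P'≈0 = trans (sym (herm4-π P P (x*0≈0 (trans (frob-cong P₃≈0) frob-0)))) (tiso a b a b)
        Q'P'≈0 : herm3 Q' P' ≈ 0#
        Q'P'≈0 = trans (sym (herm4-π Q P (x*0≈0 (trans (frob-cong P₃≈0) frob-0)))) (tiso a' b' a b)
        P'≉0 : ¬ (∀ i → P' i ≈ 0#)
        P'≉0 P'≈0 = P≉0 λ { 0F → P'≈0 0F ; 1F → P'≈0 1F ; 2F → P'≈0 2F ; 3F → P₃≈0 }
        -- if P' × Q' = 0 then Q' is isotropic, and Q isotropic would force Q₃ Q̄₃ = 0
        n≉0 : ¬ (∀ i → cross P' Q' i ≈ 0#)
        n≉0 n≈0 = *-nonzero Q₃≉0 (frob-nonzero Q₃≉0) (begin
          Q 3F * frob (Q 3F)               ≈⟨ sym (+-identityˡ _) ⟩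
          0# + Q 3F * frob (Q 3F)          ≈⟨ +-congʳ (sym Q'Q'≈0) ⟩
          herm4 Q Q                        ≈⟨ tiso a' b' a' b' ⟩
          0#                               ∎)
          where
          m = proj₁ (nonzero-coordinate P' P'≉0)
          Q'Q'≈0 = proportional-to-isotropic P' Q' n≈0 P'P'≈0 m (proj₂ (nonzero-coordinate P' P'≉0))

  -- some point of the Baer subline, namely ⟨u⟩ or ⟨v⟩, lies off π
  baer-point-off-π : ∀ u v → Generator u v →
                     Σ Carrier λ a' → Σ Carrier λ b' → InSubfield a' × InSubfield b' × ¬ (lin a' u b' v 3F ≈ 0#)
  baer-point-off-π u v gen with u 3F ≟ 0#
  ... | yes u₃≈0 = 0# , 1# , GF-q-0 , GF-q-1 , λ e → generator-leaves-π u v gen (u₃≈0 , trans (lin-0-1 u v 3F) e)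
  ... | no u₃≉0  = 1# , 0# , GF-q-1 , GF-q-0 , λ e → u₃≉0 (trans (lin-1-0 u v 3F) e)

  stabiliser-det≈1 : ∀ u v → Generator u v → Σ V4 (λ x → InBaer u v x × InPlaneπ x) →
                     ∀ A → IsGU3 A → (∀ x → InBaer u v x → InBaer u v (MA A x)) → det3 A ≈ 1#
  stabiliser-det≈1 u v gen (x₀ , (x₀≉0 , a , b , a∈ , b∈ , _ , k , x₀≈kP) , x₀∈π) A unitary preserves =
    BaerFrame.Stabiliser.det≈1 u v gen a b a' b' a∈ b∈ a'∈ b'∈ P₃≈0 P≉0 Q₃≉0 A unitary preserves
    where
    P = lin a u b v
    k≉0 : ¬ (k ≈ 0#)
    k≉0 k≈0 = x₀≉0 (λ i → trans (x₀≈kP i) (trans (*-congʳ k≈0) (zeroˡ _)))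
    P₃≈0 : P 3F ≈ 0#
    P₃≈0 = *-cancelˡ k≉0 (trans (sym (x₀≈kP 3F)) (trans x₀∈π (sym (zeroʳ k))))
    P≉0 : ¬ (∀ i → P i ≈ 0#)
    P≉0 P≈0 = x₀≉0 (λ i → trans (x₀≈kP i) (x*0≈0 (P≈0 i)))
    off-π = baer-point-off-π u v gen
    a' = proj₁ off-π
    b' = proj₁ (proj₂ off-π)
    a'∈ = proj₁ (proj₂ (proj₂ off-π))
    b'∈ = proj₁ (proj₂ (proj₂ (proj₂ off-π)))
    Q₃≉0 = proj₂ (proj₂ (proj₂ (proj₂ off-π)))

open import Data.Nat using (_*_)

-- We may take B = A: it is unitary, has determinant 1 by stabiliser-det≈1, and trivially
-- induces the same collineation as itself.
lemma2p3 : {c ℓ : Level} (q : ℕ) → IsPrimePower q →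
    (R : CommutativeRing c ℓ) → IsFiniteField R (q * q) →
    let open Hermitian R q in
    (u v : V4) → Generator u v →
    Σ V4 (λ x → InBaer u v x × InPlaneπ x) →
    (A : Mat3) → IsGU3 A → Stabilises A (InBaer u v) →
    Σ Mat3 (λ B → IsSU3 B × SameCollineation B A)
lemma2p3 q (p , k , p-prime , q≡p^k+1) R F u v gen b∩π A unitary (preserves , _) =
  A , (unitary , HermitianGeometry.stabiliser-det≈1 R q F p k p-prime q≡p^k+1 u v gen b∩π A unitary preserves) ,
  (λ x _ → 1# , λ i → sym (*-identityˡ _))
  where open CommutativeRing R using (1#; sym; *-identityˡ)
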